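{- Let $n\ge 1$ and let $D_i$ ($i<n$) be digraphs (finite or infinite) with vertex sets $V_i$. Suppose there is a single set $R$ such that $V_i\cap V_j=R$ for all $i<j<n$, and for all $i<j<n$ there is a digraph isomorphism $\psi_{i,j}:D_i\to D_j$ which is the identity on $R$. Then $D=\bigcup_{i<n}D_i$ (vertex set $\bigcup_i V_i$, arc set $\bigcup_i E(D_i)$) is a digraph. Moreover, fix an integer $k\ge 3$ and suppose each $D_i$ has digirth bigger than $k$. Then: (1) for all $i<j<n$ and $\alpha\in V_i\setminus R$, every directed path in $D$ from $\alpha$ to $\psi_{i,j}(\alpha)$ has length $>k$; (2) $D$ has digirth bigger than $k$; (3) if in addition $n>k$ and $\alpha_i\in V_i\setminus R$ ($i<n$) satisfy $\alpha_j=\psi_{i,j}(\alpha_i)$ for all $i<j<n$, and $D^*$ is the digraph with $V(D^*)=V(D)$ and $E(D^*)=E(D)\cup\{\alpha_{n-1}\alpha_0\}\cup\{\alpha_i\alpha_{i+1}:i<n-1\}$, then $D^*$ has digirth bigger than $k$.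
   Context: A digraph is a pair $D=(V,E)$ with $E\subseteq V^2$ such that $uv\in E$ implies $vu\notin E$ (no loops, no pairs of opposite arcs). The length of a path is its number of arcs. The digirth of a digraph is the length of its shortest directed cycle (infinite if there is none). -}

module Defs where

open import Data.Nat using (ℕ; zero; suc; _<_)
open import Data.Fin using (Fin; fromℕ; inject₁) renaming (zero to fzero; suc to fsuc)
open import Data.Product using (Σ; _×_; ∃; ∃-syntax)
open import Data.Sum using (_⊎_)
open import Relation.Nullary using (¬_)
open import Relation.Binary.PropositionalEquality using (_≡_)
open import Function.Bundles using (_⇔_)

-- Digraphs whose vertices live in an ambient type U: a vertex set is a
-- predicate on U and an arc set is a binary relation on U.
-- (V , E) is a digraph iff E ⊆ V² and uv ∈ E implies vu ∉ E
-- (this also excludes loops).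
record IsDigraph {U : Set} (V : U → Set) (E : U → U → Set) : Set where
  field
    arc-tail : ∀ {u v} → E u v → V u
    arc-head : ∀ {u v} → E u v → V v
    asym     : ∀ {u v} → E u v → ¬ E v u

-- A digraph isomorphism from (V , E) to (V' , E'), given as a map f defined
-- on the vertices of V (f x p for x ∈ V witnessed by p), which does not
-- depend on the membership proof, lands in V', is injective and surjective
-- onto V', and preserves and reflects arcs.
record IsIso {U : Set} (V : U → Set) (E : U → U → Set)
             (V' : U → Set) (E' : U → U → Set)
             (f : (x : U) → V x → U) : Set where
  field
    maps     : ∀ x (p : V x) → V' (f x p)
    resp     : ∀ x y (p : V x) (q : V y) → x ≡ y → f x p ≡ f y q
    inj      : ∀ x y (p : V x) (q : V y) → f x p ≡ f y q → x ≡ y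
    surj     : ∀ y → V' y → Σ U λ x → Σ (V x) λ p → f x p ≡ y
    arcs     : ∀ x y (p : V x) (q : V y) → E x y ⇔ E' (f x p) (f y q)

record Path {U : Set} (E : U → U → Set) (u v : U) (m : ℕ) : Set where
  field
    w      : Fin (suc m) → U
    start  : w fzero ≡ u
    end    : w (fromℕ m) ≡ v
    step   : ∀ (i : Fin m) → E (w (inject₁ i)) (w (fsuc i))
    inj    : ∀ i j → w i ≡ w j → i ≡ j

record Cycle {U : Set} (E : U → U → Set) (m : ℕ) : Set where
  field
    pos    : 0 < m
    w      : Fin (suc m) → U
    closed : w fzero ≡ w (fromℕ m)
    step   : ∀ (i : Fin m) → E (w (inject₁ i)) (w (fsuc i))
    inj    : ∀ (i j : Fin m) → w (inject₁ i) ≡ w (inject₁ j) → i ≡ j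

DigirthGt : {U : Set} → ℕ → (U → U → Set) → Set
DigirthGt k E = ∀ m → Cycle E m → k < m

⋃V : {U : Set} {n : ℕ} → (Fin n → U → Set) → U → Set
⋃V V u = ∃[ i ] V i u

⋃E : {U : Set} {n : ℕ} → (Fin n → U → U → Set) → U → U → Set
⋃E E u v = ∃[ i ] E i u v

StarE : {U : Set} {n' : ℕ} → (Fin (suc n') → U → U → Set) → (Fin (suc n') → U)
      → U → U → Set
StarE {n' = n'} E α u v =
  ⋃E E u v
  ⊎ ((u ≡ α (fromℕ n') × v ≡ α fzero)
  ⊎ (∃[ i ] (u ≡ α (inject₁ i) × v ≡ α (fsuc i))))

module Submission where

-- Every vertex x of the union D lies in some piece D_j, and the
-- isomorphisms ψ carry it to a well-defined vertex of any fixed piece D_i: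
-- its "projection" (ψ_{j,i} x if j < i, x if j = i, ψ_{i,j}⁻¹ x if i < j).
-- Projection does not depend on the choice of j, because a vertex in two
-- pieces lies in R, where all ψ are the identity, and it maps arcs of D to
-- arcs of D_i.  Hence a walk in D projects to a walk of the same length in
-- D_i, and everything reduces to one fact about a single digraph of digirth
-- > k: a closed walk of positive length has length > k (a closed walk of
-- length ≤ k either repeats a vertex, giving a shorter closed walk, or is a
-- cycle).  Asymmetry of D, (1) and (2) are then direct projections; for (3)
-- the new arcs α_c → α_{c+1} all project to a pause at α_0, so a cycle of D*
-- either contains an arc of D (and projects to a long closed walk of D_0 that
-- pauses at times) or consists of new arcs only, and then winds around the
-- n-cycle α_0 → ⋯ → α_{n-1} → α_0 and has length ≥ n > k.

open import Defs
open import Data.Nat using (ℕ; zero; suc; _+_; _∸_; _*_; _≤_; _<_; _≤?_; z≤n; s≤s; z<s)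
open import Data.Nat.Properties
  using ( ≤-trans; ≤-reflexive; <⇒≤; <⇒≱; ≰⇒>; <-≤-trans; ≤-<-trans; n≮0
        ; m≤n⇒m≤1+n; m∸n≤m; m<n⇒0<n∸m; m+[n∸m]≡n; +-monoʳ-<
        ; +-identityʳ; +-suc; +-assoc; +-comm; +-cancelˡ-≡; *-distribʳ-+; *-identityˡ)
  renaming (<-cmp to <-cmpℕ)
open import Data.Nat.Divisibility using (divides; ∣⇒≤)
open import Data.Nat.Induction using (<-rec)
open import Data.Fin using (Fin; toℕ; fromℕ; inject₁) renaming (zero to fzero; suc to fsuc; _<_ to _<ᶠ_)
open import Data.Fin.Properties
  using (toℕ-fromℕ; toℕ-inject₁; toℕ-injective; inject₁-injective; inject₁ℕ<; <-cmp; <-irrefl; <-asym; _≟_)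
open import Data.Product using (Σ; _×_; _,_; proj₁; ∃-syntax)
open import Data.Sum using (_⊎_; inj₁; inj₂)
open import Data.Empty using (⊥; ⊥-elim)
open import Relation.Nullary using (¬_; yes; no)
open import Relation.Binary.Definitions using (Tri; tri<; tri≈; tri>)
open import Relation.Binary.PropositionalEquality
open import Relation.Binary.Construct.Closure.Reflexive using (ReflClosure; [_]) renaming (refl to pause)
open import Function.Bundles using (_⇔_; Equivalence)

data Walk {U : Set} (E : U → U → Set) : U → U → ℕ → Set where
  []  : ∀ {x} → Walk E x x 0
  _∷_ : ∀ {x y z n} → E x y → Walk E y z n → Walk E x z (suc n)

infixr 5 _∷_ _++_

_++_ : ∀ {U} {E : U → U → Set} {x y z m n} → Walk E x y m → Walk E y z n → Walk E x z (m + n)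
[] ++ W = W
(e ∷ W₁) ++ W₂ = e ∷ (W₁ ++ W₂)

ClosedSeq : {U : Set} → (U → U → Set) → ℕ → (ℕ → U) → Set
ClosedSeq E n v = v 0 ≡ v n × (∀ s → s < n → E (v s) (v (suc s)))

module _ {U : Set} {E : U → U → Set} where

  stepsWalk : (m : ℕ) (w : Fin (suc m) → U) → (∀ i → E (w (inject₁ i)) (w (fsuc i))) →
              Walk E (w fzero) (w (fromℕ m)) m
  stepsWalk zero    w step = []
  stepsWalk (suc m) w step = step fzero ∷ stepsWalk m (λ i → w (fsuc i)) (λ i → step (fsuc i))

  pathWalk : ∀ {u v m} → Path E u v m → Walk E u v m
  pathWalk {m = m} P = subst₂ (λ a b → Walk E a b m) start end (stepsWalk m w step)
    where open Path P

  cycleWalk : ∀ {m} (C : Cycle E m) → Walk E (Cycle.w C fzero) (Cycle.w C fzero) m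
  cycleWalk {m} C = subst (λ b → Walk E (w fzero) b m) (sym closed) (stepsWalk m w step)
    where open Cycle C

  dropPauses : ∀ {x y n} → Walk (ReflClosure E) x y n → ∃[ ℓ ] ℓ ≤ n × Walk E x y ℓ
  dropPauses [] = 0 , z≤n , []
  dropPauses (pause ∷ W) = let ℓ , ℓ≤n , W′ = dropPauses W in ℓ , m≤n⇒m≤1+n ℓ≤n , W′
  dropPauses ([ e ] ∷ W) = let ℓ , ℓ≤n , W′ = dropPauses W in suc ℓ , s≤s ℓ≤n , e ∷ W′

  -- The s-th vertex of a walk (its last vertex for s beyond the length).
  vertex : ∀ {x y n} → Walk E x y n → ℕ → U
  vertex {x} []      _       = x
  vertex {x} (_ ∷ _) zero    = x
  vertex     (_ ∷ W) (suc s) = vertex W s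

  vertex-start : ∀ {x y n} (W : Walk E x y n) → vertex W 0 ≡ x
  vertex-start []      = refl
  vertex-start (_ ∷ _) = refl

  vertex-end : ∀ {x y n} (W : Walk E x y n) → vertex W n ≡ y
  vertex-end []      = refl
  vertex-end (_ ∷ W) = vertex-end W

  vertex-step : ∀ {x y n} (W : Walk E x y n) {s} → s < n → E (vertex W s) (vertex W (suc s))
  vertex-step (e ∷ W) {zero}  _         = subst (E _) (sym (vertex-start W)) e
  vertex-step (_ ∷ W) {suc s} (s≤s s<n) = vertex-step W s<n

  closedWalkSeq : ∀ {x n} (W : Walk E x x n) → ClosedSeq E n (vertex W)
  closedWalkSeq W = trans (vertex-start W) (sym (vertex-end W)) , λ s → vertex-step W

  seqCycle : ∀ {n v} → 0 < n → ClosedSeq E n v →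
             (∀ s t → s < n → t < n → v s ≡ v t → s ≡ t) → Cycle E n
  seqCycle {n} {v} pos (closed , step) distinct = record
    { pos    = pos
    ; w      = λ i → v (toℕ i)
    ; closed = trans closed (cong v (sym (toℕ-fromℕ n)))
    ; step   = λ i → subst (λ s → E (v s) (v (suc (toℕ i)))) (sym (toℕ-inject₁ i)) (step (toℕ i) (toℕ<n′ i))
    ; inj    = λ i j eq → inject₁-injective (toℕ-injective
                 (distinct _ _ (inject₁ℕ< i) (inject₁ℕ< j) eq))
    }
    where
    toℕ<n′ : (i : Fin n) → toℕ i < n
    toℕ<n′ i = subst (_< n) (toℕ-inject₁ i) (inject₁ℕ< i)

  innerLoop : ∀ {n v s t} → (∀ r → r < n → E (v r) (v (suc r))) → s < t → t ≤ n → v s ≡ v t →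
              ClosedSeq E (t ∸ s) (λ r → v (s + r))
  innerLoop {n} {v} {s} {t} step s<t t≤n vs≡vt =
    trans (cong v (+-identityʳ s)) (trans vs≡vt (cong v (sym s+[t∸s]≡t))) ,
    λ r r<t∸s → subst (λ q → E (v (s + r)) (v q)) (sym (+-suc s r))
                  (step (s + r) (<-≤-trans (+-monoʳ-< s r<t∸s) (≤-trans (≤-reflexive s+[t∸s]≡t) t≤n)))
    where
    s+[t∸s]≡t : s + (t ∸ s) ≡ t
    s+[t∸s]≡t = m+[n∸m]≡n (<⇒≤ s<t)

module _ {U : Set} {E : U → U → Set} {k : ℕ} (girth : DigirthGt k E) where

  -- No closed sequence has length between 1 and k: a repeated vertex yields a
  -- strictly shorter one, and a sequence without repetitions is a cycle.
  noShortClosedSeq : ∀ n → 0 < n → n ≤ k → ∀ v → ClosedSeq E n v → ⊥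
  noShortClosedSeq = <-rec Short shorter
    where
    Short : ℕ → Set
    Short n = 0 < n → n ≤ k → ∀ v → ClosedSeq E n v → ⊥

    shorter : ∀ n → (∀ {m} → m < n → Short m) → Short n
    shorter n ih pos n≤k v closedSeq@(_ , step) = <⇒≱ (girth n (seqCycle pos closedSeq distinct)) n≤k
      where
      noRepeat : ∀ {s t} → s < t → t < n → v s ≡ v t → ⊥
      noRepeat {s} {t} s<t t<n eq =
        ih t∸s<n (m<n⇒0<n∸m s<t) (≤-trans (<⇒≤ t∸s<n) n≤k) (λ r → v (s + r))
           (innerLoop {E = E} {v = v} step s<t (<⇒≤ t<n) eq)
        where
        t∸s<n : t ∸ s < n
        t∸s<n = ≤-<-trans (m∸n≤m t s) t<n

      distinct : ∀ s t → s < n → t < n → v s ≡ v t → s ≡ t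
      distinct s t s<n t<n eq with <-cmpℕ s t
      ... | tri< s<t _ _ = ⊥-elim (noRepeat s<t t<n eq)
      ... | tri≈ _ s≡t _ = s≡t
      ... | tri> _ _ t<s = ⊥-elim (noRepeat t<s s<n (sym eq))

  closedWalk-long : ∀ {x n} → Walk E x x n → 0 < n → k < n
  closedWalk-long {n = n} W pos with n ≤? k
  ... | yes n≤k = ⊥-elim (noShortClosedSeq n pos n≤k (vertex W) (closedWalkSeq W))
  ... | no  n≰k = ≰⇒> n≰k

  arcReturn-long : ∀ {a b m} → E a b → Walk (ReflClosure E) b a m → k < suc m
  arcReturn-long ab W =
    let ℓ , ℓ≤m , W′ = dropPauses W
    in <-≤-trans (closedWalk-long (ab ∷ W′) z<s) (s≤s ℓ≤m)

module Amalgamation {U : Set} (n′ : ℕ)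
    (V : Fin (suc n′) → U → Set) (E : Fin (suc n′) → U → U → Set)
    (R : U → Set) (ψ : (i j : Fin (suc n′)) → (x : U) → V i x → U)
    (digraph : ∀ i → IsDigraph (V i) (E i))
    (meetR : ∀ i j → i <ᶠ j → ∀ x → (V i x × V j x) ⇔ R x)
    (iso : ∀ i j → i <ᶠ j → IsIso (V i) (E i) (V j) (E j) (ψ i j))
    (fixesR : ∀ i j → i <ᶠ j → ∀ x (p : V i x) → R x → ψ i j x p ≡ x) where

  Piece : Set
  Piece = Fin (suc n′)

  shared : ∀ {j j′ x} → j ≢ j′ → V j x → V j′ x → R x
  shared {j} {j′} j≢j′ p q with <-cmp j j′
  ... | tri< j<j′ _ _ = Equivalence.to (meetR j j′ j<j′ _) (p , q)
  ... | tri≈ _ j≡j′ _ = ⊥-elim (j≢j′ j≡j′)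
  ... | tri> _ _ j′<j = Equivalence.to (meetR j′ j j′<j _) (q , p)

  -- Copy i j c x p a: a is the vertex of D_i corresponding to x ∈ V_j, by the
  -- case c of the comparison of j and i.
  Copy : (i j : Piece) → Tri (j <ᶠ i) (j ≡ i) (i <ᶠ j) → (x : U) → V j x → U → Set
  Copy i j (tri< j<i _ _) x p a = a ≡ ψ j i x p
  Copy i j (tri≈ _ _ _)   x p a = a ≡ x
  Copy i j (tri> _ _ i<j) x p a = Σ (V i a) λ q → ψ i j a q ≡ x

  copy-exists : ∀ i j c x (p : V j x) → ∃[ a ] Copy i j c x p a
  copy-exists i j (tri< _ _ _) x p = _ , refl
  copy-exists i j (tri≈ _ _ _) x p = x , refl
  copy-exists i j (tri> _ _ i<j) x p = IsIso.surj (iso i j i<j) x p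

  copy-shared : ∀ i j c {x p a} → R x → Copy i j c x p a → a ≡ x
  copy-shared i j (tri< j<i _ _) {x} {p} r refl = fixesR j i j<i x p r
  copy-shared i j (tri≈ _ _ _) r a≡x = a≡x
  copy-shared i j (tri> _ _ i<j) {x} {a = a} r (q , ψa≡x) =
    IsIso.inj (iso i j i<j) a x q x∈Vi (trans ψa≡x (sym (fixesR i j i<j x x∈Vi r)))
    where
    x∈Vi : V i x
    x∈Vi = proj₁ (Equivalence.from (meetR i j i<j x) r)

  copy-unique : ∀ i j c {x p p′ a b} → Copy i j c x p a → Copy i j c x p′ b → a ≡ b
  copy-unique i j (tri< j<i _ _) {x} {p} {p′} refl refl = IsIso.resp (iso j i j<i) x x p p′ refl
  copy-unique i j (tri≈ _ _ _) a≡x b≡x = trans a≡x (sym b≡x)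
  copy-unique i j (tri> _ _ i<j) {a = a} {b} (q , ψa≡x) (q′ , ψb≡x) =
    IsIso.inj (iso i j i<j) a b q q′ (trans ψa≡x (sym ψb≡x))

  copy-arc : ∀ i j c {x y p q a b} → E j x y → Copy i j c x p a → Copy i j c y q b → E i a b
  copy-arc i j (tri< j<i _ _) {x} {y} {p} {q} xy refl refl = Equivalence.to (IsIso.arcs (iso j i j<i) x y p q) xy
  copy-arc i j (tri≈ _ refl _) xy refl refl = xy
  copy-arc i j (tri> _ _ i<j) {a = a} {b} xy (qa , refl) (qb , refl) =
    Equivalence.from (IsIso.arcs (iso i j i<j) a b qa qb) xy

  -- Proj i x a: a is the projection to D_i of the vertex x of D.
  Proj : Piece → U → U → Set
  Proj i x a = ∃[ j ] Σ (V j x) λ p → Copy i j (<-cmp j i) x p a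

  -- Every vertex of D has a projection, and it is unique: two choices of
  -- pieces for x only differ when x ∈ R, where all copies are x itself.
  proj-exists : ∀ i j {x} → V j x → ∃[ a ] Proj i x a
  proj-exists i j {x} p = let a , c = copy-exists i j (<-cmp j i) x p in a , j , p , c

  proj-unique : ∀ {i x a b} → Proj i x a → Proj i x b → a ≡ b
  proj-unique {i} (j , p , c) (j′ , p′ , c′) with j ≟ j′
  ... | yes refl = copy-unique i j (<-cmp j i) c c′
  ... | no  j≢j′ = trans (copy-shared i j (<-cmp j i) r c) (sym (copy-shared i j′ (<-cmp j′ i) r c′))
    where
    r = shared j≢j′ p p′

  proj-arc : ∀ i {x y a} → ⋃E E x y → Proj i x a → ∃[ b ] Proj i y b × E i a b
  proj-arc i {x} {y} (j , xy) x↦a =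
    let c = <-cmp j i
        a′ , ca′ = copy-exists i j c x (IsDigraph.arc-tail (digraph j) xy)
        b , cb = copy-exists i j c y (IsDigraph.arc-head (digraph j) xy)
    in b , (j , _ , cb) , subst (λ z → E i z b) (proj-unique (j , _ , ca′) x↦a) (copy-arc i j c xy ca′ cb)

  proj-self : ∀ {i x} → V i x → Proj i x x
  proj-self {i} p = i , p , self (<-cmp i i)
    where
    self : ∀ c → Copy i i c _ p _
    self (tri< i<i _ _) = ⊥-elim (<-irrefl refl i<i)
    self (tri≈ _ _ _)   = refl
    self (tri> _ _ i<i) = ⊥-elim (<-irrefl refl i<i)

  proj-ψ : ∀ {i j x} (i<j : i <ᶠ j) (p : V i x) → Proj i (ψ i j x p) x
  proj-ψ {i} {j} {x} i<j p = j , IsIso.maps (iso i j i<j) x p , back (<-cmp j i)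
    where
    back : ∀ c → Copy i j c (ψ i j x p) (IsIso.maps (iso i j i<j) x p) x
    back (tri< j<i _ _) = ⊥-elim (<-asym i<j j<i)
    back (tri≈ _ j≡i _) = ⊥-elim (<-irrefl (sym j≡i) i<j)
    back (tri> _ _ _)   = p , refl

  -- D is a digraph: two opposite arcs of D would project to opposite arcs of
  -- a single piece.
  unionDigraph : IsDigraph (⋃V V) (⋃E E)
  unionDigraph = record
    { arc-tail = λ { (j , xy) → j , IsDigraph.arc-tail (digraph j) xy }
    ; arc-head = λ { (j , xy) → j , IsDigraph.arc-head (digraph j) xy }
    ; asym     = asym
    }
    where
    asym : ∀ {u v} → ⋃E E u v → ¬ ⋃E E v u
    asym uv@(j , uvⱼ) vu =
      let a , u↦a = proj-exists j j (IsDigraph.arc-tail (digraph j) uvⱼ)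
          b , v↦b , ab = proj-arc j uv u↦a
          a′ , u↦a′ , ba′ = proj-arc j vu v↦b
      in IsDigraph.asym (digraph j) ab (subst (E j b) (proj-unique u↦a′ u↦a) ba′)

  module _ (i : Piece) {T : U → U → Set}
           (projectStep : ∀ {x y a} → T x y → Proj i x a → ∃[ b ] Proj i y b × ReflClosure (E i) a b) where

    projectWalk : ∀ {x y m a} → Walk T x y m → Proj i x a → ∃[ b ] Proj i y b × Walk (ReflClosure (E i)) a b m
    projectWalk [] x↦a = _ , x↦a , []
    projectWalk (xy ∷ W) x↦a =
      let b , y↦b , ab = projectStep xy x↦a
          c , z↦c , W′ = projectWalk W y↦b
      in c , z↦c , ab ∷ W′

    returnLength : ∀ {k} → DigirthGt k (E i) → ∀ {x y z m a} →
                   ⋃E E x y → Walk T y z m → Proj i x a → Proj i z a → k < suc m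
    returnLength girth xy W x↦a z↦a =
      let b , y↦b , ab = proj-arc i xy x↦a
          c , z↦c , W′ = projectWalk W y↦b
      in arcReturn-long girth ab (subst (λ c → Walk _ b c _) (proj-unique z↦c z↦a) W′)

  unionStep : ∀ i {x y a} → ⋃E E x y → Proj i x a → ∃[ b ] Proj i y b × ReflClosure (E i) a b
  unionStep i xy x↦a = let b , y↦b , ab = proj-arc i xy x↦a in b , y↦b , [ ab ]

  -- Part (1): a path of D from α ∈ V_i ∖ R to ψ_{i,j} α returns to the
  -- projection α of its start; it is nonempty since ψ_{i,j} α ∉ V_i.
  copyDistance : ∀ {k} i j → i <ᶠ j → DigirthGt k (E i) → ∀ α (p : V i α) → ¬ R α →
                 ∀ m → Path (⋃E E) α (ψ i j α p) m → k < m
  copyDistance i j i<j girth α p α∉R zero P =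
    ⊥-elim (α∉R (Equivalence.to (meetR i j i<j α) (p , subst (V j) (sym α≡ψα) (IsIso.maps (iso i j i<j) α p))))
    where
    α≡ψα : α ≡ ψ i j α p
    α≡ψα = trans (sym (Path.start P)) (Path.end P)
  copyDistance i j i<j girth α p α∉R (suc m) P with pathWalk P
  ... | xy ∷ W = returnLength i (unionStep i) girth xy W (proj-self p) (proj-ψ i<j p)

  -- Part (2): a cycle of D projects to a closed walk of any piece.
  unionDigirth : ∀ k i → DigirthGt k (E i) → DigirthGt k (⋃E E)
  unionDigirth k i girth zero C = ⊥-elim (n≮0 (Cycle.pos C))
  unionDigirth k i girth (suc m) C with cycleWalk C
  ... | xy@(j , xyⱼ) ∷ W =
    let a , x↦a = proj-exists i j (IsDigraph.arc-tail (digraph j) xyⱼ)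
    in returnLength i (unionStep i) girth xy W x↦a x↦a

  module Star (α : Piece → U) (p : ∀ c → V c (α c)) (α∉R : ∀ c → ¬ R (α c))
              (α-coherent : ∀ i j → i <ᶠ j → α j ≡ ψ i j (α i) (p i)) where

    N : ℕ
    N = suc n′

    NewArc : U → U → Set
    NewArc u v = (u ≡ α (fromℕ n′) × v ≡ α fzero) ⊎ ∃[ c ] (u ≡ α (inject₁ c) × v ≡ α (fsuc c))

    -- The α_c are distinct, since a vertex of two pieces lies in R.
    α-injective : ∀ {c c′} → α c ≡ α c′ → c ≡ c′
    α-injective {c} {c′} eq with c ≟ c′
    ... | yes c≡c′ = c≡c′
    ... | no  c≢c′ = ⊥-elim (α∉R c (shared c≢c′ (p c) (subst (V c′) (sym eq) (p c′))))

    α-proj : ∀ c → Proj fzero (α c) (α fzero)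
    α-proj fzero    = proj-self (p fzero)
    α-proj (fsuc c) = subst (λ y → Proj fzero y (α fzero)) (sym (α-coherent fzero (fsuc c) z<s)) (proj-ψ z<s (p fzero))

    starStep : ∀ {x y a} → StarE E α x y → Proj fzero x a → ∃[ b ] Proj fzero y b × ReflClosure (E fzero) a b
    starStep (inj₁ xy) x↦a = unionStep fzero xy x↦a
    starStep {a = a} (inj₂ new) x↦a with new
    ... | inj₁ (refl , refl)    = α fzero , α-proj fzero , subst (λ b → ReflClosure _ a b) (proj-unique x↦a (α-proj _)) pause
    ... | inj₂ (c , refl , refl) = α fzero , α-proj (fsuc c) , subst (λ b → ReflClosure _ a b) (proj-unique x↦a (α-proj _)) pause

    -- Winds c c′ m: m steps forward from position c on the n-cycle of the α
    -- end at position c′ after q full turns.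
    Winds : Piece → Piece → ℕ → Set
    Winds c c′ m = ∃[ q ] toℕ c + m ≡ toℕ c′ + q * N

    winds-++ : ∀ {c c′ c″ m m′} → Winds c c′ m → Winds c′ c″ m′ → Winds c c″ (m + m′)
    winds-++ {c} {c′} {c″} {m} {m′} (q , e) (q′ , e′) = q + q′ , (begin
      toℕ c + (m + m′)            ≡⟨ sym (+-assoc (toℕ c) m m′) ⟩
      toℕ c + m + m′              ≡⟨ cong (_+ m′) e ⟩
      toℕ c′ + q * N + m′         ≡⟨ +-assoc (toℕ c′) (q * N) m′ ⟩
      toℕ c′ + (q * N + m′)       ≡⟨ cong (toℕ c′ +_) (+-comm (q * N) m′) ⟩
      toℕ c′ + (m′ + q * N)       ≡⟨ sym (+-assoc (toℕ c′) m′ (q * N)) ⟩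
      toℕ c′ + m′ + q * N         ≡⟨ cong (_+ q * N) e′ ⟩
      toℕ c″ + q′ * N + q * N     ≡⟨ +-assoc (toℕ c″) (q′ * N) (q * N) ⟩
      toℕ c″ + (q′ * N + q * N)   ≡⟨ cong (toℕ c″ +_) (+-comm (q′ * N) (q * N)) ⟩
      toℕ c″ + (q * N + q′ * N)   ≡⟨ cong (toℕ c″ +_) (sym (*-distribʳ-+ N q q′)) ⟩
      toℕ c″ + (q + q′) * N       ∎)
      where open ≡-Reasoning

    newArc-winds : ∀ {u v} → NewArc u v → ∃[ c ] ∃[ c′ ] u ≡ α c × v ≡ α c′ × Winds c c′ 1
    newArc-winds (inj₁ (u≡ , v≡)) =
      fromℕ n′ , fzero , u≡ , v≡ , 1 , trans (cong (_+ 1) (toℕ-fromℕ n′)) (trans (+-comm n′ 1) (sym (*-identityˡ N)))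
    newArc-winds (inj₂ (c , u≡ , v≡)) =
      inject₁ c , fsuc c , u≡ , v≡ , 0 , trans (cong (_+ 1) (toℕ-inject₁ c)) (trans (+-comm (toℕ c) 1) (sym (+-identityʳ _)))

    newWalk-winds : ∀ {x y m c} → Walk NewArc x y m → x ≡ α c → ∃[ c′ ] y ≡ α c′ × Winds c c′ m
    newWalk-winds {c = c} [] x≡αc = c , x≡αc , 0 , refl
    newWalk-winds (uv ∷ W) x≡αc with newArc-winds uv
    ... | c₀ , c₁ , x≡αc₀ , y≡αc₁ , w₁ with α-injective (trans (sym x≡αc) x≡αc₀)
    ... | refl = let c′ , z≡αc′ , w₂ = newWalk-winds W y≡αc₁ in c′ , z≡αc′ , winds-++ {m = 1} w₁ w₂

    newClosedWalk-long : ∀ {x m} → Walk NewArc x x m → 0 < m → N ≤ m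
    newClosedWalk-long {m = suc m} W@(uv ∷ _) _ with newArc-winds uv
    ... | c , _ , x≡αc , _ with newWalk-winds W x≡αc
    ... | c′ , x≡αc′ , q , e with α-injective (trans (sym x≡αc′) x≡αc)
    ... | refl = ∣⇒≤ (divides q (+-cancelˡ-≡ (toℕ c) (suc m) (q * N) e))

    UnionSplit : U → U → ℕ → Set
    UnionSplit x z m = ∃[ u ] ∃[ v ] ∃[ m₁ ] ∃[ m₂ ]
      Walk (StarE E α) x u m₁ × ⋃E E u v × Walk (StarE E α) v z m₂ × m₁ + suc m₂ ≡ m

    split : ∀ {x z m} → Walk (StarE E α) x z m → Walk NewArc x z m ⊎ UnionSplit x z m
    split [] = inj₁ []
    split (inj₁ xy ∷ W) = inj₂ (_ , _ , 0 , _ , [] , xy , W , refl)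
    split (inj₂ new ∷ W) with split W
    ... | inj₁ W′ = inj₁ (new ∷ W′)
    ... | inj₂ (u , v , m₁ , m₂ , W₁ , uv , W₂ , e) = inj₂ (u , v , suc m₁ , m₂ , inj₂ new ∷ W₁ , uv , W₂ , cong suc e)

    -- A cycle of D* of the second kind is rotated to start with its arc u → v
    -- of D, and then returns to u.
    starDigirth : ∀ k → DigirthGt k (E fzero) → k < N → DigirthGt k (StarE E α)
    starDigirth k girth k<N m C with split (cycleWalk C)
    ... | inj₁ W = <-≤-trans k<N (newClosedWalk-long W (Cycle.pos C))
    ... | inj₂ (u , v , m₁ , m₂ , W₁ , uv@(j , uvⱼ) , W₂ , e) =
      let a , u↦a = proj-exists fzero j (IsDigraph.arc-tail (digraph j) uvⱼ)
      in subst (k <_) (trans (cong suc (+-comm m₂ m₁)) (trans (sym (+-suc m₁ m₂)) e))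
           (returnLength fzero starStep girth uv (W₂ ++ W₁) u↦a u↦a)

lemma2p1 : {U : Set} (n' : ℕ)
    (V : Fin (suc n') → U → Set) (E : Fin (suc n') → U → U → Set)
    (R : U → Set) (ψ : (i j : Fin (suc n')) → (x : U) → V i x → U) →
    (∀ i → IsDigraph (V i) (E i)) →
    (∀ i j → i <ᶠ j → ∀ x → (V i x × V j x) ⇔ R x) →
    (∀ i j → i <ᶠ j → IsIso (V i) (E i) (V j) (E j) (ψ i j)) →
    (∀ i j → i <ᶠ j → ∀ x (p : V i x) → R x → ψ i j x p ≡ x) →
    IsDigraph (⋃V V) (⋃E E)
    × ((k : ℕ) → 3 ≤ k → (∀ i → DigirthGt k (E i)) →
        ((∀ i j → i <ᶠ j → ∀ α (p : V i α) → ¬ R α →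
            ∀ m → Path (⋃E E) α (ψ i j α p) m → k < m)
        × (DigirthGt k (⋃E E)
        × (k < suc n' → (α : Fin (suc n') → U) (p : ∀ i → V i (α i)) →
            (∀ i → ¬ R (α i)) →
            (∀ i j → i <ᶠ j → α j ≡ ψ i j (α i) (p i)) →
            DigirthGt k (StarE E α)))))
lemma2p1 n' V E R ψ digraph meetR iso fixesR =
  unionDigraph ,
  λ k _ girth →
    (λ i j i<j → copyDistance i j i<j (girth i)) ,
    unionDigirth k fzero (girth fzero) ,
    λ k<N α p α∉R α-coherent → Star.starDigirth α p α∉R α-coherent k (girth fzero) k<N
  where open Amalgamation n' V E R ψ digraph meetR iso fixesR
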